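{- Let $G$ be a finite graph, let $k$ and $d$ be positive integers, and let $v$ be a vertex of $G$. In the bridge-burning game on $G$, for $i\ge 0$ let $d_i$ denote the distance in the original graph $G$ (disregarding edge deletions) from the robber's position after his $i$th move to $v$, where $d_0$ refers to his starting vertex. If the robber can play so that $i+d_i<d$ for all $0\le i\le k-1$, and no cop begins within distance $d$ of $v$, then the cops cannot capture the robber before his $k$th move.
   Context: Bridge-burning Cops and Robbers is played on a finite graph $G$ by a team of cops and a single robber, with full information. First each cop chooses a starting vertex (several cops may share a vertex), then the robber chooses a starting vertex. The game then proceeds in rounds; in each round, first every cop either stays put or moves along an edge of the current graph to an adjacent vertex, and then the robber either stays put or moves along an edge of the current graph. Every edge traversed by the robber is immediately deleted from the graph (cop moves delete nothing). The cops win if at some moment some cop occupies the same vertex as the robber. -}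

module Defs where

open import Level using (0ℓ)
open import Data.Nat using (ℕ; zero; suc; _+_; _≤_; _<_)
open import Data.Fin using (Fin)
open import Data.Product using (Σ; _×_; ∃)
open import Data.Sum using (_⊎_)
open import Relation.Nullary using (¬_)
open import Relation.Binary.PropositionalEquality using (_≡_)
open import Relation.Binary.Definitions using (Decidable)

record Graph : Set₁ where
  field
    n      : ℕ
    Adj    : Fin n → Fin n → Set
    adj?   : Decidable Adj
    sym    : ∀ {x y} → Adj x y → Adj y x
    irrefl : ∀ {x} → ¬ Adj x x

module _ (G : Graph) where
  open Graph G

  V : Set
  V = Fin n

  -- Walks in the ORIGINAL graph G, indexed by length.
  data Walk : V → V → ℕ → Set where
    here : ∀ {u} → Walk u u 0
    step : ∀ {u w x ℓ} → Adj u w → Walk w x ℓ → Walk u x (suc ℓ)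

  WithinDist : V → V → ℕ → Set
  WithinDist u w ℓ = Σ ℕ λ ℓ' → ℓ' ≤ ℓ × Walk u w ℓ'

  -- Robber positions r : ℕ → V, r 0 = start, r i = position after his i-th move.
  -- The edge {x , y} has been deleted before round j iff the robber traversed it
  -- in one of his moves 1 , … , j-1 (move (suc i) goes from r i to r (suc i)).
  Deleted : (ℕ → V) → ℕ → V → V → Set
  Deleted r j x y = Σ ℕ λ i → suc i < j ×
    ((r i ≡ x × r (suc i) ≡ y) ⊎ (r i ≡ y × r (suc i) ≡ x))

  CurAdj : (ℕ → V) → ℕ → V → V → Set
  CurAdj r j x y = Adj x y × ¬ Deleted r j x y

  CopsMoveLegal : ∀ {m} → (ℕ → Fin m → V) → (ℕ → V) → ℕ → Set
  CopsMoveLegal cops r j = ∀ t →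
    cops (suc j) t ≡ cops j t ⊎ CurAdj r (suc j) (cops j t) (cops (suc j) t)

  -- In round (suc j) the robber stays or moves along an edge of the current graph
  -- (that edge is then deleted, as recorded by Deleted).
  RobberMoveLegal : (ℕ → V) → ℕ → Set
  RobberMoveLegal r j = r (suc j) ≡ r j ⊎ CurAdj r (suc j) (r j) (r (suc j))

  -- cops j t : position of cop t after the cops' j-th move (j = 0: start).
  -- A legal play through the cops' k-th move (i.e. everything before the
  -- robber's k-th move).
  LegalUpTo : ∀ {m} → (ℕ → Fin m → V) → (ℕ → V) → ℕ → Set
  LegalUpTo cops r k =
    (∀ j → j < k → CopsMoveLegal cops r j) ×
    (∀ j → suc j < k → RobberMoveLegal r j)

  -- No cop ever shares a vertex with the robber at any moment before the
  -- robber's k-th move: after the robber's j-th move (j < k; j = 0 is the start)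
  -- and after the cops' (suc j)-th move (robber still at r j).
  NoCaptureBefore : ∀ {m} → (ℕ → Fin m → V) → (ℕ → V) → ℕ → Set
  NoCaptureBefore cops r k = ∀ j → j < k → ∀ t →
    ¬ (cops j t ≡ r j) × ¬ (cops (suc j) t ≡ r j)

module Submission where

-- A cop moves at most one edge of G per round (the current
-- graph is a subgraph of G, so its edges are edges of G).  Hence a cop that
-- starts at distance more than d from v is, after its j-th move, at distance
-- more than d - j from v: were it within distance ℓ of v with j + ℓ ≤ d, then
-- one move earlier it would have been within distance ℓ + 1 (prepend the edge
-- just used), and inducting back to the start contradicts the hypothesis.
-- The robber, after his i-th move, is within distance ℓ of v with i + ℓ < d.
-- So at time i (cops after their i-th or (i+1)-th move, robber at r i) the
-- cop is strictly too far from v to stand on the robber's vertex.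

open import Defs
open import Data.Nat using (ℕ; zero; suc; _+_; _≤_; _<_; s≤s)
open import Data.Nat.Properties using (≤-trans; n≤1+n; +-suc; <⇒≤)
open import Data.Fin using (Fin)
open import Data.Product using (Σ; _×_; _,_; proj₁)
open import Data.Sum using (_⊎_; inj₁; inj₂)
open import Relation.Nullary using (¬_)
open import Relation.Binary.PropositionalEquality using (_≡_; subst; sym)

module _ (G : Graph) where
  open Graph G using (Adj)

  within-step : ∀ {u w v ℓ} → Adj u w → WithinDist G w v ℓ →
                WithinDist G u v (suc ℓ)
  within-step a (ℓ' , ℓ'≤ℓ , walk) = suc ℓ' , s≤s ℓ'≤ℓ , step a walk

  within-mono : ∀ {u v ℓ ℓ₁} → ℓ ≤ ℓ₁ → WithinDist G u v ℓ → WithinDist G u v ℓ₁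
  within-mono ℓ≤ℓ₁ (ℓ' , ℓ'≤ℓ , walk) = ℓ' , ≤-trans ℓ'≤ℓ ℓ≤ℓ₁ , walk

  stays-far : (k d : ℕ) (v : V G) (c : ℕ → V G) →
    (∀ j → j < k → c (suc j) ≡ c j ⊎ Adj (c j) (c (suc j))) →
    ¬ WithinDist G (c 0) v d →
    ∀ j → j ≤ k → ∀ ℓ → j + ℓ ≤ d → ¬ WithinDist G (c j) v ℓ
  stays-far k d v c moves far zero _ ℓ ℓ≤d near = far (within-mono ℓ≤d near)
  stays-far k d v c moves far (suc j) j<k ℓ [1+j]+ℓ≤d near =
    stays-far k d v c moves far j (<⇒≤ j<k) (suc ℓ) j+[1+ℓ]≤d one-step-earlier
    where
    j+[1+ℓ]≤d : j + suc ℓ ≤ d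
    j+[1+ℓ]≤d = subst (_≤ d) (sym (+-suc j ℓ)) [1+j]+ℓ≤d

    one-step-earlier : WithinDist G (c j) v (suc ℓ)
    one-step-earlier with moves j j<k
    ... | inj₁ stayed = within-mono (n≤1+n ℓ)
                          (subst (λ x → WithinDist G x v ℓ) stayed near)
    ... | inj₂ edge   = within-step edge near

  -- In a legal play every cop moves along edges of the current graph, which
  -- are edges of G, so the invariant applies to each cop.
  cop-stays-far : (k d : ℕ) (v : V G) (m : ℕ) (cops : ℕ → Fin m → V G)
    (r : ℕ → V G) → LegalUpTo G cops r k →
    (∀ t → ¬ WithinDist G (cops 0 t) v d) →
    ∀ t j → j ≤ k → ∀ ℓ → j + ℓ ≤ d → ¬ WithinDist G (cops j t) v ℓ
  cop-stays-far k d v m cops r legal far t =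
    stays-far k d v (λ j → cops j t) moves (far t)
    where
    moves : ∀ j → j < k →
            cops (suc j) t ≡ cops j t ⊎ Adj (cops j t) (cops (suc j) t)
    moves j j<k with proj₁ legal j j<k t
    ... | inj₁ stayed     = inj₁ stayed
    ... | inj₂ (edge , _) = inj₂ edge

lemma4p7 : (G : Graph) (k d : ℕ) → 1 ≤ k → 1 ≤ d → (v : V G) →
    (m : ℕ) (cops : ℕ → Fin m → V G) (r : ℕ → V G) →
    LegalUpTo G cops r k →
    (∀ i → i < k → Σ ℕ λ ℓ → WithinDist G (r i) v ℓ × i + ℓ < d) →
    (∀ t → ¬ WithinDist G (cops 0 t) v d) →
    NoCaptureBefore G cops r k
lemma4p7 G k d _ _ v m cops r legal robber-near cops-far j j<k t
  with robber-near j j<k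
... | ℓ , robber-within , j+ℓ<d = apart-before-cop-move , apart-after-cop-move
  -- At time j the cop has made j moves (then j + 1), the robber sits at r j.
  where
  far-cop : ∀ i → i ≤ k → ∀ ℓ → i + ℓ ≤ d → ¬ WithinDist G (cops i t) v ℓ
  far-cop = cop-stays-far G k d v m cops r legal cops-far t

  cop-within : ∀ {i} → cops i t ≡ r j → WithinDist G (cops i t) v ℓ
  cop-within same = subst (λ x → WithinDist G x v ℓ) (sym same) robber-within

  apart-before-cop-move : ¬ (cops j t ≡ r j)
  apart-before-cop-move same =
    far-cop j (<⇒≤ j<k) ℓ (<⇒≤ j+ℓ<d) (cop-within same)

  apart-after-cop-move : ¬ (cops (suc j) t ≡ r j)
  apart-after-cop-move same = far-cop (suc j) j<k ℓ j+ℓ<d (cop-within same)
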